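{- For every integer $m\ge 6$, there exist a starting square $s$ and a set $B$ of $\lceil (m-1)/2\rceil$ blocks on the torus $T_{m,m}$ such that: every free square of $T_{m,m}$ is passed over by the robot during some sequence of moves starting from $s$; if $i_m$ denotes the largest index (in $\{1,\dots,m\}$) of a row containing a block of $B$, then the robot can traverse row $R_{i_m+1}$ horizontally (every free square of that row is passed over during some horizontal move); and for every column, every free square of that column is passed over during some vertical move.
   Context: $T_{m,m}$ is the $m\times m$ torus grid with rows $R_1,\dots,R_m$ and columns $C_1,\dots,C_m$, indices taken modulo $m$. Blocks occupy some squares. A move: choose one of the four directions; the robot slides (wrapping around) and stops on the last free square before a block; if the line contains no block, the robot passes over every square of that line and ends where it started. The robot passes over every square it occupies during a move. -}

module Defs where

open import Data.Nat using (ℕ; zero; suc; _+_; _*_; _∸_; _≤_; _/_; NonZero)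
open import Data.Nat.DivMod using (_mod_)
open import Data.Fin using (Fin; toℕ)
open import Data.Product using (_×_; _,_; proj₁; proj₂; Σ; ∃; ∃-syntax)
open import Data.Sum using (_⊎_)
open import Data.Unit using (⊤)
open import Data.List using (List; length)
open import Data.List.Membership.Propositional using (_∈_; _∉_)
open import Relation.Binary.PropositionalEquality using (_≡_)

ceilHalf : ℕ → ℕ
ceilHalf k = (k + 1) / 2

data Dir : Set where
  up down left right : Dir

Horizontal : Dir → Set
Horizontal d = (d ≡ left) ⊎ (d ≡ right)

Vertical : Dir → Set
Vertical d = (d ≡ up) ⊎ (d ≡ down)

module Torus (m : ℕ) .{{_ : NonZero m}} where

  -- a square (row , column); Fin index i stands for R_{i+1} / C_{i+1}
  Square : Set
  Square = Fin m × Fin m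

  row : Square → Fin m
  row = proj₁

  col : Square → Fin m
  col = proj₂

  _⊕_ : Fin m → ℕ → Fin m
  i ⊕ j = (toℕ i + j) mod m

  -- subtract j from an index, modulo m (adding j * (m - 1) ≡ - j mod m)
  _⊖_ : Fin m → ℕ → Fin m
  i ⊖ j = (toℕ i + j * (m ∸ 1)) mod m

  shift : Square → Dir → ℕ → Square
  shift (r , c) up    j = (r ⊖ j , c)
  shift (r , c) down  j = (r ⊕ j , c)
  shift (r , c) left  j = (r , c ⊖ j)
  shift (r , c) right j = (r , c ⊕ j)

  Blocks : Set
  Blocks = List Square

  Free : Blocks → Square → Set
  Free B x = x ∉ B

  -- Move B p d len : the move from p in direction d makes exactly len unit steps.
  -- Either the first block is at distance len + 1 (robot stops at distance len),
  -- or the line has no block, len = m and the robot passes over the whole line,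
  -- ending where it started.
  Move : Blocks → Square → Dir → ℕ → Set
  Move B p d len =
    (∀ j → 1 ≤ j → j ≤ len → Free B (shift p d j))
    × ((shift p d (suc len) ∈ B) ⊎ (len ≡ m))

  endOf : Square → Dir → ℕ → Square
  endOf p d len = shift p d len

  PassedIn : Blocks → Square → Dir → Square → Set
  PassedIn B p d x = ∃[ len ] (Move B p d len × ∃[ j ] (j ≤ len × x ≡ shift p d j))

  data Reachable (B : Blocks) (s : Square) : Square → Set where
    start : Reachable B s s
    step  : ∀ {p} d len → Reachable B s p → Move B p d len →
            Reachable B s (endOf p d len)

  PassedBy : (Dir → Set) → Blocks → Square → Square → Set
  PassedBy Q B s x = ∃[ p ] ∃[ d ] (Reachable B s p × Q d × PassedIn B p d x)

  AnyDir : Dir → Set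
  AnyDir _ = ⊤

  MaxBlockRow : Blocks → Fin m → Set
  MaxBlockRow B i = (∃[ b ] (b ∈ B × row b ≡ i)) × (∀ b → b ∈ B → toℕ (row b) ≤ toℕ i)

module Submission where

-- Write k = 3 + n for the number of blocks and T = k - 1, so that m ∈ {2k, 2k + 1}. Row y < k
-- carries one block, at column cf y: row 0 at column 2k - 1, row T at column 2 and every inner
-- row at column mid y, where the rows 2i and 2i + 1 hold the adjacent blocks 4i + 2 and 4i + 1.
-- A move along a line with a single block stops next to it, so a reached row y reaches the
-- columns cf y ± 1 and a reached column cf ρ reaches the rows ρ ± 1 (the record Closed). From a
-- start square chosen according to the parity of k, these rules reach every row below k (even
-- rows upwards from row T, odd rows downwards from the highest one) and then every column (each
-- pair of adjacent blocks yields four consecutive columns; the top few columns are checked by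
-- hand). A reached column is then swept by two vertical moves, and row k, which lies next to the
-- block of row T, is swept by one horizontal move.

open import Defs
open import Data.Nat using (ℕ; zero; suc; pred; _+_; _*_; _∸_; _≤_; _<_; z≤n; s≤s; NonZero; >-nonZero; _≟_; _<?_; _%_)
open import Data.Nat.Properties
open import Data.Nat.DivMod using (_mod_; _/_; m≡m%n+[m/n]*n; m<n⇒m%n≡m; m%n<n; m%n%n≡m%n; %-distribˡ-+; [m+n]%n≡m%n; [m+kn]%n≡m%n)
open import Data.Fin using (Fin; toℕ; fromℕ<)
open import Data.Fin.Properties using (toℕ-fromℕ<; toℕ-injective; toℕ<n; any?)
open import Data.List using (length; tabulate)
open import Data.List.Properties using (length-tabulate)
open import Data.List.Membership.Propositional.Properties using (∈-tabulate⁺; ∈-tabulate⁻)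
open import Data.List.Relation.Unary.Unique.Propositional using (Unique)
open import Data.List.Relation.Unary.Unique.Propositional.Properties using (tabulate⁺)
open import Data.List.Membership.Propositional using (_∈_; _∉_)
open import Data.Unit using (tt)
open import Data.Product using (_×_; _,_; proj₁; proj₂; ∃-syntax)
open import Data.Sum using (inj₁; inj₂)
open import Relation.Nullary using (¬_; yes; no; contradiction)
open import Relation.Binary.PropositionalEquality
open import Function using (_∘_)

module Cyclic (m : ℕ) .{{_ : NonZero m}} where

  open Torus m
  open ≡-Reasoning

  %-absorbˡ : ∀ x y → (x % m + y) % m ≡ (x + y) % m
  %-absorbˡ x y = begin
    (x % m + y) % m          ≡⟨ %-distribˡ-+ (x % m) y m ⟩
    (x % m % m + y % m) % m  ≡⟨ cong (λ z → (z + y % m) % m) (m%n%n≡m%n x m) ⟩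
    (x % m + y % m) % m      ≡⟨ %-distribˡ-+ x y m ⟨
    (x + y) % m              ∎

  toℕ-⊕ : ∀ a j → toℕ (a ⊕ j) ≡ (toℕ a + j) % m
  toℕ-⊕ a j = toℕ-fromℕ< _

  toℕ-⊖ : ∀ a j → toℕ (a ⊖ j) ≡ (toℕ a + j * (m ∸ 1)) % m
  toℕ-⊖ a j = toℕ-fromℕ< _

  toℕ%m : ∀ (a : Fin m) → toℕ a % m ≡ toℕ a
  toℕ%m a = m<n⇒m%n≡m (toℕ<n a)

  j+j*[m∸1] : ∀ j → j + j * (m ∸ 1) ≡ j * m
  j+j*[m∸1] j = trans (sym (*-suc j (m ∸ 1))) (cong (j *_) (suc-pred m))

  ⊕-identityʳ : ∀ a → a ⊕ 0 ≡ a
  ⊕-identityʳ a = toℕ-injective (trans (toℕ-⊕ a 0) (trans (cong (_% m) (+-identityʳ (toℕ a))) (toℕ%m a)))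

  ⊖-identityʳ : ∀ a → a ⊖ 0 ≡ a
  ⊖-identityʳ = ⊕-identityʳ

  ⊕-assoc : ∀ a i j → (a ⊕ i) ⊕ j ≡ a ⊕ (i + j)
  ⊕-assoc a i j = toℕ-injective (begin
    toℕ ((a ⊕ i) ⊕ j)            ≡⟨ toℕ-⊕ (a ⊕ i) j ⟩
    (toℕ (a ⊕ i) + j) % m        ≡⟨ cong (λ z → (z + j) % m) (toℕ-⊕ a i) ⟩
    ((toℕ a + i) % m + j) % m    ≡⟨ %-absorbˡ (toℕ a + i) j ⟩
    (toℕ a + i + j) % m          ≡⟨ cong (_% m) (+-assoc (toℕ a) i j) ⟩
    (toℕ a + (i + j)) % m        ≡⟨ toℕ-⊕ a (i + j) ⟨
    toℕ (a ⊕ (i + j))            ∎)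

  ⊖-cancel : ∀ a j → (a ⊕ j) ⊖ j ≡ a
  ⊖-cancel a j = toℕ-injective (begin
    toℕ ((a ⊕ j) ⊖ j)                    ≡⟨ toℕ-⊖ (a ⊕ j) j ⟩
    (toℕ (a ⊕ j) + j * (m ∸ 1)) % m      ≡⟨ cong (λ z → (z + j * (m ∸ 1)) % m) (toℕ-⊕ a j) ⟩
    ((toℕ a + j) % m + j * (m ∸ 1)) % m  ≡⟨ %-absorbˡ (toℕ a + j) _ ⟩
    (toℕ a + j + j * (m ∸ 1)) % m        ≡⟨ cong (_% m) (trans (+-assoc (toℕ a) j _) (cong (toℕ a +_) (j+j*[m∸1] j))) ⟩
    (toℕ a + j * m) % m                  ≡⟨ [m+kn]%n≡m%n (toℕ a) j m ⟩
    toℕ a % m                            ≡⟨ toℕ%m a ⟩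
    toℕ a                                ∎)

  ⊕-cancel : ∀ a j → (a ⊖ j) ⊕ j ≡ a
  ⊕-cancel a j = toℕ-injective (begin
    toℕ ((a ⊖ j) ⊕ j)                    ≡⟨ toℕ-⊕ (a ⊖ j) j ⟩
    (toℕ (a ⊖ j) + j) % m                ≡⟨ cong (λ z → (z + j) % m) (toℕ-⊖ a j) ⟩
    ((toℕ a + j * (m ∸ 1)) % m + j) % m  ≡⟨ %-absorbˡ (toℕ a + j * (m ∸ 1)) j ⟩
    (toℕ a + j * (m ∸ 1) + j) % m        ≡⟨ cong (_% m) (trans (+-assoc (toℕ a) _ j) (cong (toℕ a +_) (trans (+-comm _ j) (j+j*[m∸1] j)))) ⟩
    (toℕ a + j * m) % m                  ≡⟨ [m+kn]%n≡m%n (toℕ a) j m ⟩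
    toℕ a % m                            ≡⟨ toℕ%m a ⟩
    toℕ a                                ∎)

  ⌞_⌟ : ℕ → Fin m
  ⌞ j ⌟ = j mod m

  ⌞toℕ⌟ : ∀ a → ⌞ toℕ a ⌟ ≡ a
  ⌞toℕ⌟ a = toℕ-injective (trans (toℕ-fromℕ< _) (toℕ%m a))

  ⊕-comm : ∀ a j → a ⊕ j ≡ ⌞ j ⌟ ⊕ toℕ a
  ⊕-comm a j = toℕ-injective (begin
    toℕ (a ⊕ j)                  ≡⟨ toℕ-⊕ a j ⟩
    (toℕ a + j) % m              ≡⟨ cong (_% m) (+-comm (toℕ a) j) ⟩
    (j + toℕ a) % m              ≡⟨ %-absorbˡ j (toℕ a) ⟨
    (j % m + toℕ a) % m          ≡⟨ cong (λ z → (z + toℕ a) % m) (toℕ-fromℕ< _) ⟨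
    (toℕ ⌞ j ⌟ + toℕ a) % m      ≡⟨ toℕ-⊕ ⌞ j ⌟ (toℕ a) ⟨
    toℕ (⌞ j ⌟ ⊕ toℕ a)          ∎)

  ⊕-⊖-start : ∀ a j → (a ⊕ j) ⊖ toℕ a ≡ ⌞ j ⌟
  ⊕-⊖-start a j = trans (cong (_⊖ toℕ a) (⊕-comm a j)) (⊖-cancel ⌞ j ⌟ (toℕ a))

  ⊕-injective : ∀ a {i j} → i < m → j < m → a ⊕ i ≡ a ⊕ j → i ≡ j
  ⊕-injective a {i} {j} i<m j<m e = begin
    i                            ≡⟨ m<n⇒m%n≡m i<m ⟨
    i % m                        ≡⟨ toℕ-fromℕ< _ ⟨
    toℕ ⌞ i ⌟                    ≡⟨ cong toℕ (⊕-⊖-start a i) ⟨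
    toℕ ((a ⊕ i) ⊖ toℕ a)        ≡⟨ cong (λ z → toℕ (z ⊖ toℕ a)) e ⟩
    toℕ ((a ⊕ j) ⊖ toℕ a)        ≡⟨ cong toℕ (⊕-⊖-start a j) ⟩
    toℕ ⌞ j ⌟                    ≡⟨ toℕ-fromℕ< _ ⟩
    j % m                        ≡⟨ m<n⇒m%n≡m j<m ⟩
    j                            ∎

  gap : Fin m → Fin m → ℕ
  gap a b = toℕ (b ⊖ toℕ a)

  gap<m : ∀ a b → gap a b < m
  gap<m a b = toℕ<n (b ⊖ toℕ a)

  ⊕-gap : ∀ a b → a ⊕ gap a b ≡ b
  ⊕-gap a b = begin
    a ⊕ gap a b                  ≡⟨ ⊕-comm a (gap a b) ⟩
    ⌞ gap a b ⌟ ⊕ toℕ a          ≡⟨ cong (_⊕ toℕ a) (⌞toℕ⌟ (b ⊖ toℕ a)) ⟩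
    (b ⊖ toℕ a) ⊕ toℕ a          ≡⟨ ⊕-cancel b (toℕ a) ⟩
    b                            ∎

  gap-unique : ∀ a b {j} → j < m → a ⊕ j ≡ b → j ≡ gap a b
  gap-unique a b j<m e = ⊕-injective a j<m (gap<m a b) (trans e (sym (⊕-gap a b)))

  gap-before : ∀ a b {j} → j < gap a b → a ⊕ j ≢ b
  gap-before a b j<g e = <⇒≢ j<g (gap-unique a b (<-trans j<g (gap<m a b)) e)

  gap-suc : ∀ {a b} → a ≢ b → suc (pred (gap a b)) ≡ gap a b
  gap-suc {a} {b} a≢b with gap a b in eq
  ... | suc g = refl
  ... | zero  = contradiction (trans (sym (⊕-identityʳ a)) (subst (λ z → a ⊕ z ≡ b) eq (⊕-gap a b))) a≢b

  gap-stop : ∀ {a b} → a ≢ b → a ⊕ pred (gap a b) ≡ b ⊖ 1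
  gap-stop {a} {b} a≢b = begin
    a ⊕ g                        ≡⟨ ⊖-cancel (a ⊕ g) 1 ⟨
    ((a ⊕ g) ⊕ 1) ⊖ 1            ≡⟨ cong (_⊖ 1) (⊕-assoc a g 1) ⟩
    (a ⊕ (g + 1)) ⊖ 1            ≡⟨ cong (λ z → (a ⊕ z) ⊖ 1) (trans (+-comm g 1) (gap-suc a≢b)) ⟩
    (a ⊕ gap a b) ⊖ 1            ≡⟨ cong (_⊖ 1) (⊕-gap a b) ⟩
    b ⊖ 1                        ∎
    where
    g : ℕ
    g = pred (gap a b)

  ⊖-before : ∀ a b {j} → j < gap b a → a ⊖ j ≢ b
  ⊖-before a b j<g e = gap-before b a j<g (trans (cong (_⊕ _) (sym e)) (⊕-cancel a _))

  ⊖-gap : ∀ a b → a ⊖ gap b a ≡ b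
  ⊖-gap a b = trans (cong (_⊖ gap b a) (sym (⊕-gap b a))) (⊖-cancel b (gap b a))

  ⊖-stop : ∀ {a b} → a ≢ b → a ⊖ pred (gap b a) ≡ b ⊕ 1
  ⊖-stop {a} {b} a≢b = begin
    a ⊖ g                        ≡⟨ cong (_⊖ g) (sym (⊕-gap b a)) ⟩
    (b ⊕ gap b a) ⊖ g            ≡⟨ cong (λ z → (b ⊕ z) ⊖ g) (gap-suc (a≢b ∘ sym)) ⟨
    (b ⊕ (1 + g)) ⊖ g            ≡⟨ cong (_⊖ g) (⊕-assoc b 1 g) ⟨
    ((b ⊕ 1) ⊕ g) ⊖ g            ≡⟨ ⊖-cancel (b ⊕ 1) g ⟩
    b ⊕ 1                        ∎
    where
    g : ℕ
    g = pred (gap b a)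

  toℕ-⊖1 : ∀ {b c} → toℕ b ≡ suc c → toℕ (b ⊖ 1) ≡ c
  toℕ-⊖1 {b} {c} e = begin
    toℕ (b ⊖ 1)                   ≡⟨ toℕ-⊖ b 1 ⟩
    (toℕ b + 1 * (m ∸ 1)) % m     ≡⟨ cong (_% m) (cong₂ _+_ e (+-identityʳ (m ∸ 1))) ⟩
    (suc c + (m ∸ 1)) % m         ≡⟨ cong (_% m) (trans (sym (+-suc c (m ∸ 1))) (cong (c +_) (suc-pred m))) ⟩
    (c + m) % m                   ≡⟨ [m+n]%n≡m%n c m ⟩
    c % m                         ≡⟨ m<n⇒m%n≡m (<-trans (n<1+n c) (subst (_< m) e (toℕ<n b))) ⟩
    c                             ∎

  toℕ-⊕1 : ∀ {b} → suc (toℕ b) < m → toℕ (b ⊕ 1) ≡ suc (toℕ b)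
  toℕ-⊕1 {b} lt = trans (toℕ-⊕ b 1) (trans (cong (_% m) (+-comm (toℕ b) 1)) (m<n⇒m%n≡m lt))

  gap-around : ∀ b x → x ≢ b → gap (b ⊕ 1) x < gap (b ⊕ 1) b
  gap-around b x x≢b = ≤∧≢⇒< (subst (gap u x ≤_) (sym round) (<⇒≤pred (gap<m u x)))
                              (λ e → x≢b (trans (sym (⊕-gap u x)) (trans (cong (u ⊕_) e) (⊕-gap u b))))
    where
    u : Fin m
    u = b ⊕ 1
    full : u ⊕ (m ∸ 1) ≡ b
    full = begin
      u ⊕ (m ∸ 1)          ≡⟨ ⊕-assoc b 1 (m ∸ 1) ⟩
      b ⊕ suc (m ∸ 1)      ≡⟨ cong (b ⊕_) (suc-pred m) ⟩
      b ⊕ m                ≡⟨ toℕ-injective (trans (toℕ-⊕ b m) (trans ([m+n]%n≡m%n (toℕ b) m) (toℕ%m b))) ⟩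
      b                    ∎
    round : gap u b ≡ m ∸ 1
    round = sym (gap-unique u b (subst (pred m <_) (suc-pred m) (n<1+n (pred m))) full)

module Moves (m : ℕ) .{{_ : NonZero m}} where

  open Torus m
  open Cyclic m

  shift-zero : ∀ p d → shift p d 0 ≡ p
  shift-zero (r , c) up    = cong (_, c) (⊖-identityʳ r)
  shift-zero (r , c) down  = cong (_, c) (⊕-identityʳ r)
  shift-zero (r , c) left  = cong (r ,_) (⊖-identityʳ c)
  shift-zero (r , c) right = cong (r ,_) (⊕-identityʳ c)

  reachable-free : ∀ {B s p} → Free B s → Reachable B s p → Free B p
  reachable-free s-free start                    = s-free
  reachable-free s-free (step {p} d zero r _)    = subst (Free _) (sym (shift-zero p d)) (reachable-free s-free r)
  reachable-free s-free (step d (suc len) _ mv)  = proj₁ mv (suc len) (s≤s z≤n) ≤-refl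

  -- Moves along a line (a row or a column, parametrised by Fin m) whose only block is at b.
  module BlockedLine (B : Blocks) (line : Fin m → Square) (b : Fin m)
                     (only-b : ∀ t → line t ∈ B → t ≡ b) (b-blocked : line b ∈ B) where

    forward : ∀ d → (∀ a j → shift (line a) d j ≡ line (a ⊕ j)) →
              ∀ a → a ≢ b → Move B (line a) d (pred (gap a b))
    forward d walk a a≢b = clear , inj₁ hit
      where
      clear : ∀ j → 1 ≤ j → j ≤ pred (gap a b) → Free B (shift (line a) d j)
      clear j _ j≤ mem = gap-before a b (subst (j <_) (gap-suc a≢b) (s≤s j≤))
                                        (only-b _ (subst (_∈ B) (walk a j) mem))
      hit : shift (line a) d (suc (pred (gap a b))) ∈ B
      hit = subst (_∈ B) (sym (trans (walk a _) (cong line (trans (cong (a ⊕_) (gap-suc a≢b)) (⊕-gap a b))))) b-blocked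

    forward-end : ∀ d → (walk : ∀ a j → shift (line a) d j ≡ line (a ⊕ j)) →
                  ∀ a → a ≢ b → endOf (line a) d (pred (gap a b)) ≡ line (b ⊖ 1)
    forward-end d walk a a≢b = trans (walk a _) (cong line (gap-stop a≢b))

    backward : ∀ d → (∀ a j → shift (line a) d j ≡ line (a ⊖ j)) →
               ∀ a → a ≢ b → Move B (line a) d (pred (gap b a))
    backward d walk a a≢b = clear , inj₁ hit
      where
      clear : ∀ j → 1 ≤ j → j ≤ pred (gap b a) → Free B (shift (line a) d j)
      clear j _ j≤ mem = ⊖-before a b (subst (j <_) (gap-suc (a≢b ∘ sym)) (s≤s j≤))
                                      (only-b _ (subst (_∈ B) (walk a j) mem))
      hit : shift (line a) d (suc (pred (gap b a))) ∈ B
      hit = subst (_∈ B) (sym (trans (walk a _) (cong line (trans (cong (a ⊖_) (gap-suc (a≢b ∘ sym))) (⊖-gap a b))))) b-blocked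

    backward-end : ∀ d → (walk : ∀ a j → shift (line a) d j ≡ line (a ⊖ j)) →
                   ∀ a → a ≢ b → endOf (line a) d (pred (gap b a)) ≡ line (b ⊕ 1)
    backward-end d walk a a≢b = trans (walk a _) (cong line (⊖-stop a≢b))

    forward-passes : ∀ d → (walk : ∀ a j → shift (line a) d j ≡ line (a ⊕ j)) →
                     b ⊕ 1 ≢ b → ∀ t → t ≢ b → PassedIn B (line (b ⊕ 1)) d (line t)
    forward-passes d walk u≢b t t≢b =
      pred (gap (b ⊕ 1) b) , forward d walk (b ⊕ 1) u≢b ,
      gap (b ⊕ 1) t , <⇒≤pred (gap-around b t t≢b) , sym (trans (walk _ _) (cong line (⊕-gap (b ⊕ 1) t)))

  module OpenLine (B : Blocks) (line : Fin m → Square) (clear : ∀ t → line t ∉ B) where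

    passes : ∀ d → (∀ a j → shift (line a) d j ≡ line (a ⊕ j)) →
             ∀ a t → PassedIn B (line a) d (line t)
    passes d walk a t = m , ((λ j _ _ → subst (_∉ B) (sym (walk a j)) (clear _)) , inj₂ refl)
                          , gap a t , <⇒≤ (gap<m a t) , sym (trans (walk a _) (cong line (⊕-gap a t)))

-- Closure rules satisfied by the sets R of reached rows and C of reached columns, when row
-- y < k carries exactly one block, at column cf y, and no other row carries a block.
record Closed (m k : ℕ) (cf : ℕ → ℕ) (R C : ℕ → Set) : Set where
  field
    -- moving right (left) in a reached row y stops just before (after) its block
    col-before : ∀ {y c} → y < k → R y → cf y ≡ suc c → C c
    col-after  : ∀ {y} → y < k → R y → suc (cf y) < m → C (suc (cf y))
    -- moving up (down) in the column of the block of row ρ stops just below (above) it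
    row-after  : ∀ {ρ} → ρ < k → C (cf ρ) → R (suc ρ)
    row-before : ∀ {ρ} → suc ρ < k → C (cf (suc ρ)) → R ρ

module Configuration (m : ℕ) .{{_ : NonZero m}} (k : ℕ) (k<m : k < m) (cf : ℕ → ℕ)
         (cf<m : ∀ y → y < k → cf y < m)
         (cf-injective : ∀ {y z} → y < k → z < k → cf y ≡ cf z → y ≡ z) where

  open Torus m
  open Cyclic m
  open Moves m

  block : Fin k → Square
  block i = (fromℕ< (<-trans (toℕ<n i) k<m) , cf (toℕ i) mod m)

  blocks : Blocks
  blocks = tabulate block

  blocks-unique : Unique blocks
  blocks-unique = tabulate⁺ λ {i} {j} e → toℕ-injective
    (trans (sym (toℕ-fromℕ< _)) (trans (cong (toℕ ∘ proj₁) e) (toℕ-fromℕ< _)))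

  toℕ-cf-mod : ∀ {y} → y < k → toℕ (cf y mod m) ≡ cf y
  toℕ-cf-mod y<k = trans (toℕ-fromℕ< _) (m<n⇒m%n≡m (cf<m _ y<k))

  ∈-blocks⁻ : ∀ {x} → x ∈ blocks → toℕ (row x) < k × toℕ (col x) ≡ cf (toℕ (row x))
  ∈-blocks⁻ mem with ∈-tabulate⁻ mem
  ... | i , refl = subst (_< k) (sym (toℕ-fromℕ< _)) (toℕ<n i)
                 , trans (toℕ-cf-mod (toℕ<n i)) (cong cf (sym (toℕ-fromℕ< _)))

  ∈-blocks⁺ : ∀ {x} → toℕ (row x) < k → toℕ (col x) ≡ cf (toℕ (row x)) → x ∈ blocks
  ∈-blocks⁺ {r , c} lt e = subst (_∈ blocks) (cong₂ _,_ same-row same-col) (∈-tabulate⁺ (fromℕ< lt))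
    where
    same-row : fromℕ< (<-trans (toℕ<n (fromℕ< lt)) k<m) ≡ r
    same-row = toℕ-injective (trans (toℕ-fromℕ< _) (toℕ-fromℕ< lt))
    same-col : cf (toℕ (fromℕ< lt)) mod m ≡ c
    same-col = toℕ-injective (trans (toℕ-cf-mod (toℕ<n (fromℕ< lt))) (trans (cong cf (toℕ-fromℕ< lt)) (sym e)))

  row-block : ∀ {r} (r<k : toℕ r < k) → (r , cf (toℕ r) mod m) ∈ blocks
  row-block r<k = ∈-blocks⁺ r<k (toℕ-cf-mod r<k)

  column-block : ∀ {c ρ} (ρ<k : ρ < k) → toℕ c ≡ cf ρ → (fromℕ< (<-trans ρ<k k<m) , c) ∈ blocks
  column-block ρ<k c≡ = ∈-blocks⁺ (subst (_< k) (sym (toℕ-fromℕ< _)) ρ<k) (trans c≡ (cong cf (sym (toℕ-fromℕ< _))))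

  module RowLine (r : Fin m) (r<k : toℕ r < k) = BlockedLine blocks (r ,_) (cf (toℕ r) mod m)
    (λ t mem → toℕ-injective (trans (proj₂ (∈-blocks⁻ mem)) (sym (toℕ-cf-mod r<k))))
    (row-block r<k)

  -- the column c = cf ρ as a line: by injectivity of cf its only block sits in row ρ
  module ColumnLine (c : Fin m) {ρ} (ρ<k : ρ < k) (c≡ : toℕ c ≡ cf ρ) =
    BlockedLine blocks (_, c) (fromℕ< (<-trans ρ<k k<m))
    (λ t mem → toℕ-injective (trans (cf-injective (proj₁ (∈-blocks⁻ mem)) ρ<k (trans (sym (proj₂ (∈-blocks⁻ mem))) c≡))
                                    (sym (toℕ-fromℕ< _))))
    (column-block ρ<k c≡)

  module Walk (s : Square) (s-free : Free blocks s) where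

    RowReached : ℕ → Set
    RowReached y = ∃[ p ] (Reachable blocks s p × toℕ (row p) ≡ y)

    ColReached : ℕ → Set
    ColReached c = ∃[ p ] (Reachable blocks s p × toℕ (col p) ≡ c)

    off-row-block : ∀ {r a} → Reachable blocks s (r , a) → (r<k : toℕ r < k) → a ≢ cf (toℕ r) mod m
    off-row-block reach r<k refl = reachable-free s-free reach (row-block r<k)

    off-column-block : ∀ {t c ρ} → Reachable blocks s (t , c) → (ρ<k : ρ < k) → toℕ c ≡ cf ρ →
                       t ≢ fromℕ< (<-trans ρ<k k<m)
    off-column-block reach ρ<k c≡ refl = reachable-free s-free reach (column-block ρ<k c≡)

    closed : Closed m k cf RowReached ColReached
    closed = record { col-before = col-before ; col-after = col-after
                    ; row-after = row-after ; row-before = row-before }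
      where
      col-before : ∀ {y c} → y < k → RowReached y → cf y ≡ suc c → ColReached c
      col-before y<k ((r , a) , reach , refl) e =
        _ , step right _ reach (forward right (λ _ _ → refl) a a≢b) ,
        trans (cong (toℕ ∘ col) (forward-end right (λ _ _ → refl) a a≢b)) (toℕ-⊖1 (trans (toℕ-cf-mod y<k) e))
        where
        open RowLine r y<k
        a≢b : a ≢ cf (toℕ r) mod m
        a≢b = off-row-block reach y<k

      col-after : ∀ {y} → y < k → RowReached y → suc (cf y) < m → ColReached (suc (cf y))
      col-after y<k ((r , a) , reach , refl) lt =
        _ , step left _ reach (backward left (λ _ _ → refl) a a≢b) ,
        trans (cong (toℕ ∘ col) (backward-end left (λ _ _ → refl) a a≢b))
              (trans (toℕ-⊕1 (subst (λ z → suc z < m) (sym (toℕ-cf-mod y<k)) lt)) (cong suc (toℕ-cf-mod y<k)))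
        where
        open RowLine r y<k
        a≢b : a ≢ cf (toℕ r) mod m
        a≢b = off-row-block reach y<k

      row-after : ∀ {ρ} → ρ < k → ColReached (cf ρ) → RowReached (suc ρ)
      row-after {ρ} ρ<k ((t , c) , reach , c≡) =
        _ , step up _ reach (backward up (λ _ _ → refl) t t≢b) ,
        trans (cong (toℕ ∘ row) (backward-end up (λ _ _ → refl) t t≢b))
              (trans (toℕ-⊕1 (subst (λ z → suc z < m) (sym (toℕ-fromℕ< _)) (≤-<-trans ρ<k k<m)))
                     (cong suc (toℕ-fromℕ< _)))
        where
        open ColumnLine c ρ<k c≡
        t≢b : t ≢ fromℕ< (<-trans ρ<k k<m)
        t≢b = off-column-block reach ρ<k c≡

      row-before : ∀ {ρ} → suc ρ < k → ColReached (cf (suc ρ)) → RowReached ρ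
      row-before {ρ} ρ<k ((t , c) , reach , c≡) =
        _ , step down _ reach (forward down (λ _ _ → refl) t t≢b) ,
        trans (cong (toℕ ∘ row) (forward-end down (λ _ _ → refl) t t≢b)) (toℕ-⊖1 (toℕ-fromℕ< (<-trans ρ<k k<m)))
        where
        open ColumnLine c ρ<k c≡
        t≢b : t ≢ fromℕ< (<-trans ρ<k k<m)
        t≢b = off-column-block reach ρ<k c≡

    -- a reached column is swept completely: moving up stops just below its block (if any), and
    -- from there moving down passes over every other square of the column
    column-swept : ∀ {t c} → Reachable blocks s (t , c) → ∀ x → Free blocks (x , c) →
                   PassedBy Vertical blocks s (x , c)
    column-swept {t} {c} reach x x-free with any? (λ (i : Fin k) → cf (toℕ i) ≟ toℕ c)
    ... | yes (i , cf≡) = (b ⊕ 1 , c) , down , reach-u , inj₂ refl ,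
                          forward-passes down (λ _ _ → refl) u≢b x x≢b
      where
      open ColumnLine c (toℕ<n i) (sym cf≡)
      b : Fin m
      b = fromℕ< (<-trans (toℕ<n i) k<m)
      b-blocked : (b , c) ∈ blocks
      b-blocked = column-block (toℕ<n i) (sym cf≡)
      t≢b : t ≢ b
      t≢b = off-column-block reach (toℕ<n i) (sym cf≡)
      reach-u : Reachable blocks s (b ⊕ 1 , c)
      reach-u = subst (Reachable blocks s) (backward-end up (λ _ _ → refl) t t≢b)
                      (step up _ reach (backward up (λ _ _ → refl) t t≢b))
      u≢b : b ⊕ 1 ≢ b
      u≢b e = reachable-free s-free reach-u (subst (λ z → (z , c) ∈ blocks) (sym e) b-blocked)
      x≢b : x ≢ b
      x≢b refl = x-free b-blocked
    ... | no no-block = (t , c) , down , reach , inj₂ refl , passes down (λ _ _ → refl) t x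
      where
      open OpenLine blocks (_, c) (λ r mem → no-block (fromℕ< (proj₁ (∈-blocks⁻ mem)) ,
                                               trans (cong cf (toℕ-fromℕ< _)) (sym (proj₂ (∈-blocks⁻ mem)))))

    row-swept : ∀ {r a} → Reachable blocks s (r , a) → k ≤ toℕ r → ∀ x → PassedBy Horizontal blocks s (r , x)
    row-swept {r} {a} reach k≤r x = (r , a) , right , reach , inj₂ refl , passes right (λ _ _ → refl) a x
      where open OpenLine blocks (r ,_) (λ t mem → <⇒≱ (proj₁ (∈-blocks⁻ mem)) k≤r)

    vertical : (∀ c → c < m → ColReached c) → ∀ x → Free blocks x → PassedBy Vertical blocks s x
    vertical all-columns (x , c) x-free with all-columns (toℕ c) (toℕ<n c)
    ... | (t , c') , reach , e with toℕ-injective e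
    ... | refl = column-swept reach x x-free

    horizontal : RowReached k → ∀ x → toℕ (row x) ≡ k → PassedBy Horizontal blocks s x
    horizontal ((r , a) , reach , r≡k) (r' , x) r'≡k with toℕ-injective (trans r≡k (sym r'≡k))
    ... | refl = row-swept reach (≤-reflexive (sym r≡k)) x

  above-top-row : ∀ {i} → MaxBlockRow blocks i → toℕ (i ⊕ 1) ≡ k
  above-top-row {i} ((b , b∈ , b-row) , below) = trans (toℕ-⊕1 (subst (_< m) (sym i≡) k<m)) i≡
    where
    i<k : toℕ i < k
    i<k = subst (λ r → toℕ r < k) b-row (proj₁ (∈-blocks⁻ b∈))
    k≡ : suc (pred k) ≡ k
    k≡ = suc-pred k {{>-nonZero (≤-<-trans z≤n i<k)}}
    top : pred k < k
    top = subst (pred k <_) k≡ (n<1+n (pred k))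
    i≡ : suc (toℕ i) ≡ k
    i≡ = trans (cong suc (≤-antisym (<⇒≤pred i<k)
                 (subst (_≤ toℕ i) (trans (toℕ-fromℕ< _) (toℕ-fromℕ< top)) (below _ (∈-tabulate⁺ (fromℕ< top)))))) k≡

data Parity : ℕ → Set where
  even : ∀ i → Parity (i * 2)
  odd  : ∀ i → Parity (suc (i * 2))

parity : ∀ y → Parity y
parity zero = even zero
parity (suc zero) = odd zero
parity (suc (suc y)) with parity y
... | even i = even (suc i)
... | odd i  = odd (suc i)

double-≤ : ∀ {i g} → i * 2 ≤ suc (g * 2) → i ≤ g
double-≤ {zero}          _                 = z≤n
double-≤ {suc i} {suc g} (s≤s (s≤s le))    = s≤s (double-≤ le)
double-≤ {suc i} {zero}  (s≤s ())

data Quarter : ℕ → Set where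
  quarter : ∀ i r → r < 4 → Quarter (r + i * 2 * 2)

quarter-of : ∀ c → Quarter c
quarter-of c = subst Quarter (sym c≡) (quarter (c / 4) (c % 4) (m%n<n c 4))
  where
  c≡ : c ≡ c % 4 + c / 4 * 2 * 2
  c≡ = trans (m≡m%n+[m/n]*n c 4) (cong (c % 4 +_) (sym (*-assoc (c / 4) 2 2)))

-- Columns of the blocks in the inner rows of the construction: rows i * 2 and suc (i * 2)
-- hold adjacent blocks, at columns 2 + 4i and 1 + 4i.
mid : ℕ → ℕ
mid 0 = 2
mid 1 = 1
mid (suc (suc y)) = 4 + mid y

mid-even : ∀ i → mid (i * 2) ≡ 2 + i * 2 * 2
mid-even zero    = refl
mid-even (suc i) = cong (4 +_) (mid-even i)

mid-odd : ∀ i → mid (suc (i * 2)) ≡ suc (i * 2 * 2)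
mid-odd zero    = refl
mid-odd (suc i) = cong (4 +_) (mid-odd i)

mid-bound : ∀ y → mid y ≤ 2 + y * 2
mid-bound zero          = ≤-refl
mid-bound (suc zero)    = s≤s z≤n
mid-bound (suc (suc y)) = +-monoʳ-≤ 4 (mid-bound y)

mid-injective : ∀ {y z} → mid y ≡ mid z → y ≡ z
mid-injective {zero}        {zero}        _ = refl
mid-injective {suc zero}    {suc zero}    _ = refl
mid-injective {suc (suc y)} {suc (suc z)} e = cong (suc ∘ suc) (mid-injective (+-cancelˡ-≡ 4 _ _ e))
mid-injective {zero}        {suc (suc _)} ()
mid-injective {suc zero}    {suc (suc _)} ()
mid-injective {suc (suc _)} {zero}        ()
mid-injective {suc (suc _)} {suc zero}    ()

mid-positive≢2 : ∀ y → mid (suc y) ≢ 2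
mid-positive≢2 zero    ()
mid-positive≢2 (suc y) ()

module Design (n m : ℕ) (6+2n≤m : 6 + n * 2 ≤ m) (m≤7+2n : m ≤ 7 + n * 2) where

  k T : ℕ
  k = 3 + n
  T = 2 + n

  k<m : k < m
  k<m = ≤-trans (s≤s (s≤s (s≤s (s≤s (m≤n⇒m≤1+n (m≤n⇒m≤1+n (m≤m*n n 2))))))) 6+2n≤m

  beyond-m : ∀ {c} → 7 + n * 2 ≤ c → ¬ (c < m)
  beyond-m le lt = <⇒≱ (≤-trans lt m≤7+2n) le

  cf : ℕ → ℕ
  cf zero = 5 + n * 2
  cf (suc y) with suc y ≟ T
  ... | yes _ = 2
  ... | no _  = mid (suc y)

  cf-top : cf T ≡ 2
  cf-top with T ≟ T
  ... | yes _ = refl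
  ... | no T≢T = contradiction refl T≢T

  cf-inner : ∀ {y} → 1 ≤ y → y < T → cf y ≡ mid y
  cf-inner {suc y} _ y<T with suc y ≟ T
  ... | yes e = contradiction e (<⇒≢ y<T)
  ... | no _  = refl

  data RowKind : ℕ → Set where
    bottom : RowKind 0
    top    : RowKind T
    inner  : ∀ {y} → 1 ≤ y → y < T → RowKind y

  row-kind : ∀ {y} → y < k → RowKind y
  row-kind {zero}  _ = bottom
  row-kind {suc y} (s≤s y<k) with m≤n⇒m<n∨m≡n y<k
  ... | inj₁ y<T  = inner (s≤s z≤n) y<T
  ... | inj₂ refl = top

  column : ∀ {y} → RowKind y → ℕ
  column bottom            = 5 + n * 2
  column top               = 2
  column (inner {y} _ _)   = mid y

  cf-kind : ∀ {y} (κ : RowKind y) → cf y ≡ column κ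
  cf-kind bottom          = refl
  cf-kind top             = cf-top
  cf-kind (inner 1≤y y<T) = cf-inner 1≤y y<T

  inner-bound : ∀ {y} → y < T → mid y ≤ 4 + n * 2
  inner-bound {y} (s≤s y≤) = ≤-trans (mid-bound y) (+-monoʳ-≤ 2 (*-monoˡ-≤ 2 y≤))

  column<m : ∀ {y} (κ : RowKind y) → column κ < m
  column<m bottom        = 6+2n≤m
  column<m top           = ≤-trans (s≤s (s≤s (s≤s z≤n))) 6+2n≤m
  column<m (inner _ y<T) = ≤-trans (s≤s (inner-bound y<T)) (≤-trans (n≤1+n _) 6+2n≤m)

  cf<m : ∀ y → y < k → cf y < m
  cf<m y y<k = subst (_< m) (sym (cf-kind (row-kind y<k))) (column<m (row-kind y<k))

  same-column-as-bottom : ∀ {z} (κ : RowKind z) → column bottom ≡ column κ → z ≡ 0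
  same-column-as-bottom bottom             _ = refl
  same-column-as-bottom (inner _ z<T)      e = contradiction (sym e) (<⇒≢ (s≤s (inner-bound z<T)))

  same-column-as-top : ∀ {z} (κ : RowKind z) → column top ≡ column κ → z ≡ T
  same-column-as-top top                       _ = refl
  same-column-as-top (inner {suc z} _ _)       e = contradiction (sym e) (mid-positive≢2 z)

  column-injective : ∀ {y z} (κ : RowKind y) (λ′ : RowKind z) → column κ ≡ column λ′ → y ≡ z
  column-injective bottom         λ′           e = sym (same-column-as-bottom λ′ e)
  column-injective top            λ′           e = sym (same-column-as-top λ′ e)
  column-injective κ@(inner _ _) bottom       e = same-column-as-bottom κ (sym e)
  column-injective κ@(inner _ _) top          e = same-column-as-top κ (sym e)
  column-injective (inner _ _)    (inner _ _)  e = mid-injective e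

  cf-injective : ∀ {y z} → y < k → z < k → cf y ≡ cf z → y ≡ z
  cf-injective y<k z<k e = column-injective (row-kind y<k) (row-kind z<k)
    (trans (sym (cf-kind (row-kind y<k))) (trans e (cf-kind (row-kind z<k))))

  -- partner i: the row whose block sits just right of the block of row suc (i * 2)
  partner : ℕ → ℕ
  partner zero    = T
  partner (suc i) = suc i * 2

  cf-odd : ∀ i → suc (i * 2) < T → cf (suc (i * 2)) ≡ suc (i * 2 * 2)
  cf-odd i lt = trans (cf-inner (s≤s z≤n) lt) (mid-odd i)

  cf-partner : ∀ i → i * 2 < T → cf (partner i) ≡ 2 + i * 2 * 2
  cf-partner zero    _  = cf-top
  cf-partner (suc i) lt = trans (cf-inner (s≤s z≤n) lt) (mid-even (suc i))

  odd<k : ∀ i → suc (i * 2) < T → suc (i * 2) < k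
  odd<k _ = m<n⇒m<1+n

  even<T : ∀ i → suc (i * 2) < T → i * 2 < T
  even<T _ = <-trans (n<1+n _)

  partner<k : ∀ i → i * 2 < T → partner i < k
  partner<k zero    _  = ≤-refl
  partner<k (suc i) lt = m<n⇒m<1+n lt

  -- all four columns 4i, ..., 4i + 3 around the pair of blocks of rows suc (i * 2), partner i fit
  quarter-bound : ∀ i → i * 2 < T → 3 + i * 2 * 2 < m
  quarter-bound i (s≤s i*2≤1+n) = ≤-trans (s≤s (s≤s (s≤s (s≤s (*-monoˡ-≤ 2 i*2≤1+n))))) 6+2n≤m

  module Spread {R C : ℕ → Set} (closed : Closed m k cf R C) where

    open Closed closed

    -- from the partner of row suc (i * 2), the column of that row is reached, and from there
    -- the rows i * 2 and suc i * 2 around it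
    up-step : ∀ i → suc (i * 2) < T → R (partner i) → R (i * 2) × R (suc i * 2)
    up-step i lt r = row-before (odd<k i lt) odd-column , row-after (odd<k i lt) odd-column
      where
      odd-column : C (cf (suc (i * 2)))
      odd-column = col-before (partner<k i (even<T i lt)) r
                 (trans (cf-partner i (even<T i lt)) (cong suc (sym (cf-odd i lt))))

    partner-column : ∀ i → suc (i * 2) < T → R (suc (i * 2)) → C (cf (partner i))
    partner-column i lt r = subst C (sym (trans (cf-partner i (even<T i lt)) (cong suc (sym (cf-odd i lt)))))
      (col-after (odd<k i lt) r (subst (λ z → suc z < m) (sym (cf-odd i lt))
                                     (<-trans (n<1+n _) (quarter-bound i (even<T i lt)))))

    -- from row 2i + 3 the column of its partner 2i + 2 is reached, hence the row 2i + 1 next to it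
    down-step : ∀ i → suc (suc i * 2) < T → R (suc (suc i * 2)) → R (suc (i * 2))
    down-step i lt r = row-before (m<n⇒m<1+n (<-trans (n<1+n _) lt)) (partner-column (suc i) lt r)

    evens : R T → ∀ i → i * 2 < T → R (partner i)
    evens rT zero    _  = rT
    evens rT (suc i) lt = proj₂ (up-step i odd<T (evens rT i (<-trans (n<1+n _) odd<T)))
      where
      odd<T : suc (i * 2) < T
      odd<T = <-trans (n<1+n _) lt

    odds : ∀ t → suc (t * 2) < T → R (suc (t * 2)) → ∀ i → i ≤ t → R (suc (i * 2))
    odds zero    _  r .zero z≤n = r
    odds (suc t) lt r i i≤ with m≤n⇒m<n∨m≡n i≤
    ... | inj₂ refl = r
    ... | inj₁ i<t  = odds t (<-trans (n<1+n _) (<-trans (n<1+n _) lt)) (down-step t lt r) i (≤-pred i<t)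

    -- row 0 lies next to the block of row 1, whose column is reached from row T
    all-rows : R T → (∀ i → suc (i * 2) < T → R (suc (i * 2))) → ∀ y → y < k → R y
    all-rows rT odd-rows y y<k with row-kind y<k
    ... | bottom = proj₁ (up-step 0 (s≤s (s≤s z≤n)) rT)
    ... | top    = rT
    ... | inner 1≤y y<T with parity y
    ...   | even (suc i) = evens rT (suc i) y<T
    ...   | odd i        = odd-rows i y<T

    pair-columns : (∀ y → y < k → R y) → ∀ i → suc (i * 2) < T → ∀ r → r < 4 → C (r + i * 2 * 2)
    pair-columns rows i lt 0 _ = col-before (odd<k i lt) (rows _ (odd<k i lt)) (cf-odd i lt)
    pair-columns rows i lt 1 _ = col-before (partner<k i (even<T i lt)) (rows _ (partner<k i (even<T i lt)))
                                            (cf-partner i (even<T i lt))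
    pair-columns rows i lt 2 _ = subst C (cong suc (cf-odd i lt))
      (col-after (odd<k i lt) (rows _ (odd<k i lt))
                 (subst (λ z → suc z < m) (sym (cf-odd i lt)) (<-trans (n<1+n _) (quarter-bound i (even<T i lt)))))
    pair-columns rows i lt 3 _ = subst C (cong suc (cf-partner i (even<T i lt)))
      (col-after (partner<k i (even<T i lt)) (rows _ (partner<k i (even<T i lt)))
                 (subst (λ z → suc z < m) (sym (cf-partner i (even<T i lt))) (quarter-bound i (even<T i lt))))
    pair-columns rows i lt (suc (suc (suc (suc _)))) (s≤s (s≤s (s≤s (s≤s ()))))

    all-columns : (∀ y → y < k → R y) → ∀ j → (∀ i → i < j → suc (i * 2) < T) →
                  (∀ e → e + j * 2 * 2 < m → C (e + j * 2 * 2)) → ∀ c → c < m → C c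
    all-columns rows j low high c c<m with quarter-of c
    ... | quarter i r r<4 with i <? j
    ...   | yes i<j = pair-columns rows i (low i i<j) r r<4
    ...   | no  i≮j = subst C c≡ (high _ (subst (_< m) (sym c≡) c<m))
      where
      c≡ : r + i * 2 * 2 ∸ j * 2 * 2 + j * 2 * 2 ≡ r + i * 2 * 2
      c≡ = m∸n+n≡m (≤-trans (*-monoˡ-≤ 2 (*-monoˡ-≤ 2 (≮⇒≥ i≮j))) (m≤n+m _ r))

  record Start : Set₁ where
    field
      row₀ col₀  : ℕ
      row₀<k     : row₀ < k
      col₀<m     : col₀ < m
      off-block  : cf row₀ ≢ col₀
      spreads    : ∀ {R C} → Closed m k cf R C → R row₀ → C col₀ → ∀ c → c < m → C c

module OddBlockCount (g m : ℕ) (6+2n≤m : 6 + g * 2 * 2 ≤ m) (m≤7+2n : m ≤ 7 + g * 2 * 2) where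

  open Design (g * 2) m 6+2n≤m m≤7+2n

  start : Start
  start = record { row₀ = T ; col₀ = cf 0 ; row₀<k = ≤-refl ; col₀<m = cf<m 0 (s≤s z≤n)
                 ; off-block = λ e → contradiction (trans (sym cf-top) e) (λ ()) ; spreads = spreads }
    where
    spreads : ∀ {R C} → Closed m k cf R C → R T → C (cf 0) → ∀ c → c < m → C c
    spreads {R} {C} closed rT c0 = all-columns rows (suc g) low high
      where
      open Closed closed
      open Spread closed
      -- row 1 lies next to the block of row 0, and the highest odd row T - 1 next to that of row T
      top-odd : R (suc (g * 2))
      top-odd = row-before ≤-refl (partner-column 0 (s≤s (s≤s z≤n)) (row-after (s≤s z≤n) c0))
      rows : ∀ y → y < k → R y
      rows = all-rows rT (λ i lt → odds g ≤-refl top-odd i (double-≤ (m≤n⇒m≤1+n (≤-pred (≤-pred lt)))))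
      low : ∀ i → i < suc g → suc (i * 2) < T
      low i (s≤s i≤g) = s≤s (s≤s (*-monoˡ-≤ 2 i≤g))
      -- the columns from 4 + 4g = 2k - 2 on lie around the block of row 0, or are the start column
      high : ∀ e → e + suc g * 2 * 2 < m → C (e + suc g * 2 * 2)
      high 0 _  = col-before (s≤s z≤n) (rows 0 (s≤s z≤n)) refl
      high 1 _  = c0
      high 2 lt = col-after (s≤s z≤n) (rows 0 (s≤s z≤n)) lt
      high (suc (suc (suc e))) lt = contradiction lt (beyond-m (+-monoʳ-≤ 3 (m≤n+m _ e)))

-- k = 4 + 2g blocks: start in row 0, in the column 4 + 4g left free by the pairs.
module EvenBlockCount (g m : ℕ) (6+2n≤m : 6 + suc (g * 2) * 2 ≤ m)
                      (m≤7+2n : m ≤ 7 + suc (g * 2) * 2) where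

  open Design (suc (g * 2)) m 6+2n≤m m≤7+2n

  start : Start
  start = record { row₀ = 0 ; col₀ = suc g * 2 * 2 ; row₀<k = s≤s z≤n
                 ; col₀<m = ≤-trans (m≤n+m _ 3) 6+2n≤m
                 ; off-block = λ e → m≢1+n+m _ {2} (sym e) ; spreads = spreads }
    where
    spreads : ∀ {R C} → Closed m k cf R C → R 0 → C (suc g * 2 * 2) → ∀ c → c < m → C c
    spreads {R} {C} closed r0 cs = all-columns rows (suc g) low high
      where
      open Closed closed
      open Spread closed
      top-even<T : suc g * 2 < T
      top-even<T = ≤-refl
      top-even<k : suc g * 2 < k
      top-even<k = m≤n⇒m≤1+n ≤-refl
      -- row T - 1 holds the block just left of the block of row 0; around it lie row T and the
      -- highest odd row T - 2
      top-column : C (cf (partner (suc g)))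
      top-column = col-before (s≤s z≤n) r0 (sym (cong suc (cf-partner (suc g) top-even<T)))
      rows : ∀ y → y < k → R y
      rows = all-rows (row-after top-even<k top-column)
                      (λ i lt → odds g (m≤n⇒m≤1+n ≤-refl) (row-before top-even<k top-column) i
                                     (double-≤ (≤-pred (≤-pred lt))))
      low : ∀ i → i < suc g → suc (i * 2) < T
      low i (s≤s i≤g) = s≤s (s≤s (m≤n⇒m≤1+n (*-monoˡ-≤ 2 i≤g)))
      -- the columns from 4 + 4g = 2k - 4 on are the start column or lie around the blocks of
      -- rows T - 1 and 0
      high : ∀ e → e + suc g * 2 * 2 < m → C (e + suc g * 2 * 2)
      high 0 _  = cs
      high 1 _  = col-before top-even<k (rows _ top-even<k) (cf-partner (suc g) top-even<T)
      high 2 _  = col-before (s≤s z≤n) (rows 0 (s≤s z≤n)) refl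
      high 3 lt = subst C (cong suc (cf-partner (suc g) top-even<T))
                    (col-after top-even<k (rows _ top-even<k)
                               (subst (λ z → suc z < m) (sym (cf-partner (suc g) top-even<T)) lt))
      high 4 lt = col-after (s≤s z≤n) (rows 0 (s≤s z≤n)) lt
      high (suc (suc (suc (suc (suc e))))) lt = contradiction lt (beyond-m (+-monoʳ-≤ 5 (m≤n+m _ e)))

start-for : ∀ n m (6+2n≤m : 6 + n * 2 ≤ m) (m≤7+2n : m ≤ 7 + n * 2) → Design.Start n m 6+2n≤m m≤7+2n
start-for n m 6+2n≤m m≤7+2n with parity n
... | even g = OddBlockCount.start g m 6+2n≤m m≤7+2n
... | odd g  = EvenBlockCount.start g m 6+2n≤m m≤7+2n

TourProperty : (m : ℕ) .{{_ : NonZero m}} → ℕ → Set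
TourProperty m k = let open Torus m in
  ∃[ s ] ∃[ B ]
    ( Unique B
    × length B ≡ k
    × Free B s
    × (∀ x → Free B x → PassedBy AnyDir B s x)
    × (∀ i → MaxBlockRow B i →
         ∀ (x : Square) → row x ≡ i ⊕ 1 → Free B x → PassedBy Horizontal B s x)
    × (∀ (x : Square) → Free B x → PassedBy Vertical B s x) )

tour : ∀ m .{{_ : NonZero m}} n → 6 + n * 2 ≤ m → m ≤ 7 + n * 2 → TourProperty m (3 + n)
tour m n 6+2n≤m m≤7+2n =
  s , blocks , blocks-unique , length-tabulate block , s-free , any-direction , after-top-row , vertical columns
  where
  open Torus m
  open Design n m 6+2n≤m m≤7+2n
  open Start (start-for n m 6+2n≤m m≤7+2n)
  open Configuration m k k<m cf cf<m cf-injective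

  s : Square
  s = (fromℕ< (<-trans row₀<k k<m) , fromℕ< col₀<m)

  s-free : Free blocks s
  s-free mem = off-block (sym (trans (sym (toℕ-fromℕ< col₀<m))
                                     (trans (proj₂ (∈-blocks⁻ mem)) (cong cf (toℕ-fromℕ< (<-trans row₀<k k<m))))))

  open Walk s s-free

  columns : ∀ c → c < m → ColReached c
  columns = spreads closed (s , start , toℕ-fromℕ< _) (s , start , toℕ-fromℕ< _)

  -- row k lies next to the block of row T
  row-k : RowReached k
  row-k = Closed.row-after closed ≤-refl (columns (cf T) (cf<m T ≤-refl))

  after-top-row : ∀ i → MaxBlockRow blocks i →
                  ∀ x → row x ≡ i ⊕ 1 → Free blocks x → PassedBy Horizontal blocks s x
  after-top-row i i-top x x-row _ = horizontal row-k x (trans (cong toℕ x-row) (above-top-row i-top))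

  any-direction : ∀ x → Free blocks x → PassedBy AnyDir blocks s x
  any-direction x x-free with vertical columns x x-free
  ... | p , d , reach , _ , passed = p , d , reach , tt , passed

-- h = ⌈(m - 1)/2⌉ = ⌊m/2⌋ satisfies 2h ≤ m ≤ 2h + 1
half-bounds : ∀ m → 1 ≤ m → ceilHalf (m ∸ 1) * 2 ≤ m × m ≤ suc (ceilHalf (m ∸ 1) * 2)
half-bounds m 1≤m = subst (λ h → h * 2 ≤ m × m ≤ suc (h * 2)) (cong (_/ 2) (sym (m∸n+n≡m 1≤m)))
  ( subst (m / 2 * 2 ≤_) (sym m≡) (m≤n+m _ _)
  , subst (_≤ suc (m / 2 * 2)) (sym m≡) (+-monoˡ-≤ _ (≤-pred (m%n<n m 2))) )
  where
  m≡ : m ≡ m % 2 + m / 2 * 2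
  m≡ = m≡m%n+[m/n]*n m 2

three≤ : ∀ h → 5 ≤ h * 2 → 3 ≤ h
three≤ (suc (suc (suc h))) _ = s≤s (s≤s (s≤s z≤n))
three≤ (suc (suc zero)) (s≤s (s≤s (s≤s (s≤s ()))))
three≤ (suc zero) (s≤s (s≤s ()))

block-count : ∀ m → 6 ≤ m → ∃[ n ] (3 + n ≡ ceilHalf (m ∸ 1) × 6 + n * 2 ≤ m × m ≤ 7 + n * 2)
block-count m 6≤m = n , 3+n≡h , subst (λ h → h * 2 ≤ m) (sym 3+n≡h) lower
                               , subst (λ h → m ≤ suc (h * 2)) (sym 3+n≡h) upper
  where
  h : ℕ
  h = ceilHalf (m ∸ 1)
  lower : h * 2 ≤ m
  lower = proj₁ (half-bounds m (≤-trans (s≤s z≤n) 6≤m))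
  upper : m ≤ suc (h * 2)
  upper = proj₂ (half-bounds m (≤-trans (s≤s z≤n) 6≤m))
  n : ℕ
  n = h ∸ 3
  3+n≡h : 3 + n ≡ h
  3+n≡h = m+[n∸m]≡n (three≤ h (≤-pred (≤-trans 6≤m upper)))

mainTheorem4 : (m : ℕ) .{{_ : NonZero m}} → 6 ≤ m →
    let open Torus m in
    ∃[ s ] ∃[ B ]
      ( Unique B
      × length B ≡ ceilHalf (m ∸ 1)
      × Free B s
      × (∀ x → Free B x → PassedBy AnyDir B s x)
      × (∀ i → MaxBlockRow B i →
           ∀ (x : Square) → row x ≡ i ⊕ 1 → Free B x → PassedBy Horizontal B s x)
      × (∀ (x : Square) → Free B x → PassedBy Vertical B s x) )
-- the theorem: the construction with n = ⌈(m - 1)/2⌉ - 3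
mainTheorem4 m 6≤m with block-count m 6≤m
... | n , 3+n≡ , 6+2n≤m , m≤7+2n = subst (TourProperty m) 3+n≡ (tour m n 6+2n≤m m≤7+2n)
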